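{- Let $H$ be a finite simple graph with $\delta(H)\ge1$ and let $\{H=\mathcal H_1,\dots,\mathcal H_s\}$ be a $d$-sequence of $H$ with $Z=\min\{z_i(H): 2\le i\le s\}\le 0$. Let $T$ be a forest without isolated vertices of order at least $3$, let $P_T$ be the set of pendant vertices of $T$ that are adjacent to a vertex of degree at least $2$, and let $G=H+T$. If $|P_T|-|N_T(P_T)|\ge d_H-Z$, then $str(G)=|V(G)|+1$.
   Context: For a graph $G$ of order $p$, a numbering is a bijection $f:V(G)\to\{1,\dots,p\}$; $str_f(G)=\max\{f(u)+f(v): uv\in E(G)\}$ and $str(G)=\min\{str_f(G)\}$ over numberings. $\delta(\cdot)$ is minimum degree, $+$ is disjoint union, $mK_1$ is $m$ isolated vertices, $K_r$ the complete graph. A pendant vertex has degree $1$; $N_T(S)$ is the set of vertices adjacent to some vertex of $S$. Empty sums are $0$. $d$-sequence of $H$: set $\mathcal H_1=H_1=H$, $m_1=0$. For $i\ge1$, if $\mathcal H_i$ is neither of the form $mK_1$ ($m\ge1$) nor $mK_1+K_r$ ($m\ge0$, $r\ge2$), write $\mathcal H_i=m_iK_1+H_i$ where $m_i\ge0$ is the number of isolated vertices of $\mathcal H_i$ and $H_i$ has no isolated vertices; choose any vertex $u_i$ of $H_i$, let $d_i$ be its degree in $H_i$, and obtain $\mathcal H_{i+1}$ from $\mathcal H_i$ by deleting its isolated vertices, $u_i$ and all neighbors of $u_i$. Stop at the first $s$ with $\mathcal H_s=m_sK_1$, $m_s\ge1$ (set $d_s=0$) or $\mathcal H_s=m_sK_1+K_r$,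 $m_s\ge0$, $r\ge2$ (set $d_s=r-1$). Write $d_H=d_1$, $y_j(H)=m_j+1-d_j$, $z_i(H)=\sum_{j=2}^i y_j(H)$. -}

module Defs where

open import Data.Nat using (ℕ; zero; suc; _+_; _∸_; _≤_; _⊔_; _≡ᵇ_; _≤ᵇ_)
open import Data.Bool using (Bool; true; false; _∧_; not; if_then_else_)
open import Data.Fin using (Fin; zero; suc; toℕ; splitAt; inject₁; fromℕ; _≟_)
open import Data.Fin.Permutation using (Permutation′; _⟨$⟩ʳ_)
open import Data.List using (List; []; _∷_; map; foldr; allFin)
open import Data.Nat.ListAction using (sum)
open import Data.Bool.ListAction using (any)
open import Data.Product using (Σ; _×_; _,_; ∃)
open import Data.Sum using (_⊎_; inj₁; inj₂)
open import Data.Integer as ℤ using (ℤ; +_; _⊓_)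
open import Function.Definitions using (Injective)
open import Relation.Nullary using (¬_; does)
open import Relation.Binary.PropositionalEquality using (_≡_; refl)

record Graph (n : ℕ) : Set where
  field
    adj    : Fin n → Fin n → Bool
    sym    : ∀ u v → adj u v ≡ adj v u
    irrefl : ∀ v → adj v v ≡ false
open Graph public

count : ∀ {n} → (Fin n → Bool) → ℕ
count {n} p = sum (map (λ v → if p v then 1 else 0) (allFin n))

anyV : ∀ {n} → (Fin n → Bool) → Bool
anyV {n} p = any p (allFin n)

deg : ∀ {n} → Graph n → Fin n → ℕ
deg G v = count (adj G v)

MinDegPos : ∀ {n} → Graph n → Set
MinDegPos G = ∀ v → 1 ≤ deg G v

adj⊎ : ∀ {n m} → Graph n → Graph m → Fin n ⊎ Fin m → Fin n ⊎ Fin m → Bool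
adj⊎ H T (inj₁ a) (inj₁ b) = adj H a b
adj⊎ H T (inj₂ a) (inj₂ b) = adj T a b
adj⊎ H T (inj₁ _) (inj₂ _) = false
adj⊎ H T (inj₂ _) (inj₁ _) = false

adj⊎-sym : ∀ {n m} (H : Graph n) (T : Graph m) x y → adj⊎ H T x y ≡ adj⊎ H T y x
adj⊎-sym H T (inj₁ a) (inj₁ b) = sym H a b
adj⊎-sym H T (inj₂ a) (inj₂ b) = sym T a b
adj⊎-sym H T (inj₁ _) (inj₂ _) = refl
adj⊎-sym H T (inj₂ _) (inj₁ _) = refl

adj⊎-irr : ∀ {n m} (H : Graph n) (T : Graph m) x → adj⊎ H T x x ≡ false
adj⊎-irr H T (inj₁ a) = irrefl H a
adj⊎-irr H T (inj₂ a) = irrefl T a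

_⊕_ : ∀ {n m} → Graph n → Graph m → Graph (n + m)
_⊕_ {n} H T = record
  { adj    = λ x y → adj⊎ H T (splitAt n x) (splitAt n y)
  ; sym    = λ x y → adj⊎-sym H T (splitAt n x) (splitAt n y)
  ; irrefl = λ x → adj⊎-irr H T (splitAt n x)
  }

label : ∀ {p} → Permutation′ p → Fin p → ℕ
label f v = suc (toℕ (f ⟨$⟩ʳ v))

maxList : List ℕ → ℕ
maxList = foldr _⊔_ 0

-- str_f(G) = max { f(u)+f(v) : uv ∈ E(G) }   (0 if no edges)
strF : ∀ {p} → Graph p → Permutation′ p → ℕ
strF {p} G f =
  maxList (map (λ u → maxList (map (λ v → if adj G u v then label f u + label f v else 0)
                                   (allFin p)))
               (allFin p))

StrEq : ∀ {p} → Graph p → ℕ → Set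
StrEq {p} G k = (∃ λ (f : Permutation′ p) → strF G f ≡ k) × (∀ (f : Permutation′ p) → k ≤ strF G f)

-- a cycle of length 3 + j : distinct vertices c 0, …, c (2+j), consecutive adjacent,
-- last adjacent to first
HasCycle : ∀ {m} → Graph m → Set
HasCycle {m} T =
  Σ ℕ λ j → Σ (Fin (3 + j) → Fin m) λ c →
    Injective _≡_ _≡_ c ×
    (∀ (i : Fin (2 + j)) → adj T (c (inject₁ i)) (c (suc i)) ≡ true) ×
    adj T (c (fromℕ (2 + j))) (c zero) ≡ true

IsForest : ∀ {m} → Graph m → Set
IsForest T = ¬ HasCycle T

pendant : ∀ {m} → Graph m → Fin m → Bool
pendant T v = deg T v ≡ᵇ 1

inP : ∀ {m} → Graph m → Fin m → Bool
inP T v = pendant T v ∧ anyV (λ w → adj T v w ∧ (2 ≤ᵇ deg T w))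

inNP : ∀ {m} → Graph m → Fin m → Bool
inNP T v = anyV (λ w → inP T w ∧ adj T w v)

-- d-sequences.  The current graph 𝓗_i is the subgraph of H induced by the
-- set of "alive" vertices.

Alive : ℕ → Set
Alive n = Fin n → Bool

isolated : ∀ {n} → Graph n → Alive n → Fin n → Bool
isolated H A v = A v ∧ not (anyV (λ w → A w ∧ adj H v w))

nonIso : ∀ {n} → Graph n → Alive n → Fin n → Bool
nonIso H A v = A v ∧ anyV (λ w → A w ∧ adj H v w)

degA : ∀ {n} → Graph n → Alive n → Fin n → ℕ
degA H A v = count (λ w → A w ∧ adj H v w)

IsMK1 : ∀ {n} → Graph n → Alive n → Set
IsMK1 H A = (∀ v → nonIso H A v ≡ false) × (∃ λ v → A v ≡ true)

-- 𝓗 = m K₁ + K_r with m ≥ 0, r ≥ 2 : the non-isolated vertices form a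
-- (nonempty, hence r ≥ 2) clique
IsMK1Kr : ∀ {n} → Graph n → Alive n → Set
IsMK1Kr H A =
  (∀ u v → nonIso H A u ≡ true → nonIso H A v ≡ true → ¬ u ≡ v → adj H u v ≡ true) ×
  (∃ λ v → nonIso H A v ≡ true)

IsTerminal : ∀ {n} → Graph n → Alive n → Set
IsTerminal H A = IsMK1 H A ⊎ IsMK1Kr H A

next : ∀ {n} → Graph n → Alive n → Fin n → Alive n
next H A u v = nonIso H A v ∧ not (does (u ≟ v)) ∧ not (adj H u v)

-- DSeq H A L : L is the list of pairs (m_i , d_i), i = current … s, of a
-- d-sequence starting from the current graph 𝓗 (given by A).
data DSeq {n} (H : Graph n) : Alive n → List (ℕ × ℕ) → Set where
  stopK1  : ∀ {A} → IsMK1 H A → DSeq H A ((count (isolated H A) , 0) ∷ [])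
  stopKr  : ∀ {A} → IsMK1Kr H A →
            DSeq H A ((count (isolated H A) , count (nonIso H A) ∸ 1) ∷ [])
  step    : ∀ {A L} → ¬ IsTerminal H A → (u : Fin n) → nonIso H A u ≡ true →
            DSeq H (next H A u) L →
            DSeq H A ((count (isolated H A) , degA H A u) ∷ L)

allAlive : ∀ {n} → Alive n
allAlive _ = true

yval : ℕ × ℕ → ℤ
yval (m , d) = (+ m ℤ.+ + 1) ℤ.- + d

zsFrom : ℤ → List (ℕ × ℕ) → List ℤ
zsFrom acc [] = []
zsFrom acc (x ∷ xs) = (acc ℤ.+ yval x) ∷ zsFrom (acc ℤ.+ yval x) xs

-- Z = min { z_i : 2 ≤ i ≤ s } given the list (m_2,d_2) ∷ … ∷ (m_s,d_s)
Zmin : ℕ × ℕ → List (ℕ × ℕ) → ℤ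
Zmin x xs = foldr _⊓_ (yval x) (zsFrom (yval x) xs)

{-# OPTIONS --safe #-}
-- Every vertex of H + T has a neighbour, so whichever vertex is numbered
-- p = |V(G)| forces str ≥ p + 1.  For the converse, labels are handed out
-- from both ends: low ones 1, 2, … and high ones p, p − 1, …, a vertex getting
-- a high label only once all its neighbours are labelled, and the low labels
-- never outnumbering the high ones by more than one; then every edge has label
-- sum at most p + 1.  First each pendant vertex of T is labelled high right
-- after its neighbour of degree ≥ 2 is labelled low, which spends at most
-- |N_T(P_T)| low against |P_T| high labels.  Then H is processed along the
-- d-sequence: the m_i isolated vertices of 𝓗_i high, the d_i neighbours of u_i
-- low, u_i high; the surplus |P_T| − |N_T(P_T)| ≥ d_H − Z is exactly what keeps
-- every prefix balanced.  Finally the rest of the forest T is peeled off leaf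
-- by leaf, each leaf high right after its neighbour low.
module Submission where

open import Defs hiding (sym)
open import Data.Nat using (ℕ; zero; suc; _+_; _∸_; _≤_; _<_; z≤n; s≤s; _<?_; _≡ᵇ_)
  renaming (_≟_ to _≟ℕ_)
open import Data.Nat.Properties hiding (_≟_)
open import Data.Nat.ListAction using (sum)
open import Data.Integer as ℤ using (ℤ; +_; 0ℤ; _⊓_)
import Data.Integer.Properties as ℤ
open import Data.Integer.Solver using (module +-*-Solver)
open import Data.Bool using (Bool; true; false; _∧_; _∨_; not; if_then_else_)
open import Data.Bool.Properties
  using (T-≡; ∧-zeroʳ; ∧-identityʳ; ∧-inverseʳ; ∧-conicalˡ; ∧-conicalʳ; not-involutive; ¬-not)
  renaming (_≟_ to _≟ᵇ_)
open import Data.Bool.ListAction using (or)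
open import Data.Fin using (Fin; zero; suc; toℕ; _≟_; fromℕ; fromℕ<; inject₁; punchOut; _↑ˡ_; _↑ʳ_; splitAt)
open import Data.Fin.Properties
  using ( any?; pigeonhole; injective⇒≤; punchOut-injective; toℕ-injective; toℕ<n
        ; toℕ-inject₁; toℕ-fromℕ; toℕ-fromℕ<
        ; splitAt-↑ˡ; splitAt-↑ʳ; join-splitAt; ↑ˡ-injective; ↑ʳ-injective )
open import Data.Fin.Permutation using (Permutation′; _⟨$⟩ʳ_; _⟨$⟩ˡ_; inverseʳ; permutation)
open import Data.List using (List; []; _∷_; map; foldr; allFin; tabulate)
open import Data.List.Properties using (map-tabulate; map-cong)
open import Data.List.Relation.Unary.Any using (here; there)
open import Data.List.Relation.Unary.Any.Properties using (any⁺; any⁻)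
open import Data.List.Membership.Propositional using (_∈_; lose; find)
open import Data.List.Membership.Propositional.Properties using (∈-allFin)
open import Data.Product using (Σ; _×_; _,_; proj₁; proj₂)
open import Data.Sum using (_⊎_; inj₁; inj₂; [_,_]′)
open import Data.Unit using (⊤; tt)
open import Function using (_∘_; id)
open import Function.Bundles using (Equivalence)
open import Function.Definitions using (Injective)
open import Relation.Nullary using (¬_; Dec; does; yes; no; contradiction)
open import Relation.Nullary.Decidable using (dec-true; dec-false; _×-dec_)
open import Relation.Binary.Definitions using (tri<; tri≈; tri>)
open import Relation.Binary.PropositionalEquality
  using (_≡_; _≢_; refl; sym; trans; cong; cong₂; subst; subst₂; module ≡-Reasoning)

VertexSet : ℕ → Set
VertexSet n = Fin n → Bool

∅ : ∀ {n} → VertexSet n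
∅ _ = false

full : ∀ {n} → VertexSet n
full _ = true

_∖_ : ∀ {n} → VertexSet n → Fin n → VertexSet n
(p ∖ x) v = p v ∧ not (does (x ≟ v))

_─_ : ∀ {n} → VertexSet n → VertexSet n → VertexSet n
(p ─ q) v = p v ∧ not (q v)

true≢false : ∀ {A : Set} → true ≡ false → A
true≢false ()

∧true-≡ : ∀ {b c} → b ∧ true ≡ c → b ≡ c
∧true-≡ {b} = trans (sym (∧-identityʳ b))

∖-self : ∀ {n} (p : VertexSet n) x → (p ∖ x) x ≡ false
∖-self p x rewrite dec-true (x ≟ x) refl = ∧-zeroʳ (p x)

∖-other : ∀ {n} (p : VertexSet n) {x v} → x ≢ v → (p ∖ x) v ≡ p v
∖-other p {x} {v} x≢v rewrite dec-false (x ≟ v) x≢v = ∧-identityʳ (p v)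

∖-absent : ∀ {n} (p : VertexSet n) {x} → p x ≡ false → ∀ v → (p ∖ x) v ≡ p v
∖-absent p {x} px v with x ≟ v
... | yes refl = trans (∧-zeroʳ (p x)) (sym px)
... | no _     = ∧-identityʳ (p v)

∖-⊆ : ∀ {n} {p q : VertexSet n} → (∀ v → p v ≡ true → q v ≡ true) →
      ∀ x v → (p ∖ x) v ≡ true → (q ∖ x) v ≡ true
∖-⊆ {p = p} {q} p⊆q x v h with x ≟ v
... | yes refl = true≢false (trans (sym h) (∧-zeroʳ (p x)))
... | no _     = trans (∧-identityʳ (q v)) (p⊆q v (∧true-≡ h))

∖-─-∖ : ∀ {n} (p q : VertexSet n) {x} → q x ≡ true → ∀ v → ((p ∖ x) ─ (q ∖ x)) v ≡ (p ─ q) v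
∖-─-∖ p q {x} qx v with x ≟ v
... | yes refl rewrite qx = trans (cong (_∧ true) (∧-zeroʳ (p x))) (sym (∧-zeroʳ (p x)))
... | no _     = cong₂ (λ b c → b ∧ not c) (∧-identityʳ (p v)) (∧-identityʳ (q v))

bit : Bool → ℕ
bit b = if b then 1 else 0

-- Same value as count, but by recursion on n, so that it computes on
-- predicates over Fin (suc n).
card : ∀ {n} → VertexSet n → ℕ
card {zero}  p = 0
card {suc n} p = bit (p zero) + card (p ∘ suc)

count≡card : ∀ {n} (p : VertexSet n) → count p ≡ card p
count≡card p = trans (cong sum (map-tabulate id (bit ∘ p))) (sum-tabulate p)
  where
  sum-tabulate : ∀ {n} (p : VertexSet n) → sum (tabulate (bit ∘ p)) ≡ card p
  sum-tabulate {zero}  p = refl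
  sum-tabulate {suc n} p = cong (_+_ (bit (p zero))) (sum-tabulate (p ∘ suc))

card-cong : ∀ {n} {p q : VertexSet n} → (∀ v → p v ≡ q v) → card p ≡ card q
card-cong {zero}  e = refl
card-cong {suc n} e = cong₂ _+_ (cong bit (e zero)) (card-cong (e ∘ suc))

card-split : ∀ {n} (p q : VertexSet n) →
             card p ≡ card (λ v → p v ∧ q v) + card (λ v → p v ∧ not (q v))
card-split {zero}  p q = refl
card-split {suc n} p q with p zero | q zero | card-split (p ∘ suc) (q ∘ suc)
... | true  | true  | ih = cong suc ih
... | true  | false | ih = trans (cong suc ih) (sym (+-suc _ _))
... | false | _     | ih = ih

card-mono : ∀ {n} {p q : VertexSet n} → (∀ v → p v ≡ true → q v ≡ true) → card p ≤ card q
card-mono {zero}  h = z≤n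
card-mono {suc n} {p} {q} h with p zero in e₁ | q zero in e₂
... | true  | true  = s≤s (card-mono (h ∘ suc))
... | true  | false = true≢false (trans (sym (h zero e₁)) e₂)
... | false | true  = m≤n⇒m≤1+n (card-mono (h ∘ suc))
... | false | false = card-mono (h ∘ suc)

card-∅ : ∀ {n} {p : VertexSet n} → (∀ v → p v ≡ false) → card p ≡ 0
card-∅ {n} e = trans (card-cong e) (card-const {n})
  where
  card-const : ∀ {n} → card (∅ {n}) ≡ 0
  card-const {zero}  = refl
  card-const {suc n} = card-const {n}

card-full : ∀ n → card (full {n}) ≡ n
card-full zero    = refl
card-full (suc n) = cong suc (card-full n)

card-witness : ∀ {n} (p : VertexSet n) → 1 ≤ card p → Σ (Fin n) λ v → p v ≡ true
card-witness {suc n} p h with p zero in e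
... | true  = zero , e
... | false = let v , pv = card-witness (p ∘ suc) h in suc v , pv

card-positive : ∀ {n} (p : VertexSet n) v → p v ≡ true → 1 ≤ card p
card-positive p zero    e rewrite e = s≤s z≤n
card-positive p (suc v) e = ≤-trans (card-positive (p ∘ suc) v e) (m≤n+m _ _)

card≡0⇒∅ : ∀ {n} (p : VertexSet n) → card p ≡ 0 → ∀ v → p v ≡ false
card≡0⇒∅ p e v with p v in pv
... | false = refl
... | true  = contradiction (subst (1 ≤_) e (card-positive p v pv)) λ ()

─-∅ : ∀ {n} (p q : VertexSet n) → card q ≡ 0 → ∀ v → (p ─ q) v ≡ p v
─-∅ p q e v rewrite card≡0⇒∅ q e v = ∧-identityʳ (p v)

card-∖ : ∀ {n} (p : VertexSet n) x → p x ≡ true → card p ≡ suc (card (p ∖ x))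
card-∖ p x e = trans (card-split p (λ v → does (x ≟ v))) (cong (_+ card (p ∖ x)) (only-x p x e))
  where
  only-x : ∀ {n} (p : VertexSet n) x → p x ≡ true → card (λ v → p v ∧ does (x ≟ v)) ≡ 1
  only-x p zero e rewrite e = cong suc (card-∅ (λ v → ∧-zeroʳ (p (suc v))))
  only-x p (suc x) e with p zero
  ... | true  = only-x (p ∘ suc) x e
  ... | false = only-x (p ∘ suc) x e

card-∖-≤ : ∀ {n} (p : VertexSet n) x → card p ≤ suc (card (p ∖ x))
card-∖-≤ p x with p x in px
... | true  = ≤-reflexive (card-∖ p x px)
... | false = m≤n⇒m≤1+n (≤-reflexive (card-cong (sym ∘ ∖-absent p px)))

card-∨ : ∀ {n} (p q : VertexSet n) → card (λ v → p v ∨ q v) ≤ card p + card q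
card-∨ {zero}  p q = z≤n
card-∨ {suc n} p q with p zero | q zero | card-∨ (p ∘ suc) (q ∘ suc)
... | true  | true  | ih = s≤s (≤-trans ih (+-monoʳ-≤ _ (n≤1+n _)))
... | true  | false | ih = s≤s ih
... | false | true  | ih = subst (suc (card (λ v → p (suc v) ∨ q (suc v))) ≤_) (sym (+-suc _ _)) (s≤s ih)
... | false | false | ih = ih

anyV-intro : ∀ {n} (p : VertexSet n) v → p v ≡ true → anyV p ≡ true
anyV-intro p v e = Equivalence.to T-≡ (any⁺ p (lose (∈-allFin v) (Equivalence.from T-≡ e)))

anyV-witness : ∀ {n} (p : VertexSet n) → anyV p ≡ true → Σ (Fin n) λ v → p v ≡ true
anyV-witness {n} p e with v , _ , pv ← find (any⁻ p (allFin n) (Equivalence.from T-≡ e)) = v , Equivalence.to T-≡ pv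

anyV-none : ∀ {n} (p : VertexSet n) → anyV p ≡ false → ∀ v → p v ≡ false
anyV-none p e v with p v in pv
... | false = refl
... | true  = true≢false (trans (sym (anyV-intro p v pv)) e)

anyV-∅ : ∀ {n} (p : VertexSet n) → (∀ v → p v ≡ false) → anyV p ≡ false
anyV-∅ p none with anyV p in e
... | false = refl
... | true  = let v , pv = anyV-witness p e in true≢false (trans (sym pv) (none v))

anyV-cong : ∀ {n} {p q : VertexSet n} → (∀ v → p v ≡ q v) → anyV p ≡ anyV q
anyV-cong {n} e = cong or (map-cong e (allFin n))

maxList-map-≤ : ∀ {A : Set} (g : A → ℕ) {b} xs → (∀ x → g x ≤ b) → maxList (map g xs) ≤ b
maxList-map-≤ g []       h = z≤n
maxList-map-≤ g (x ∷ xs) h = ⊔-lub (h x) (maxList-map-≤ g xs h)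

≤-maxList-map : ∀ {A : Set} (g : A → ℕ) {x} {xs} → x ∈ xs → g x ≤ maxList (map g xs)
≤-maxList-map g (here refl) = m≤m⊔n _ _
≤-maxList-map g (there x∈xs) = ≤-trans (≤-maxList-map g x∈xs) (m≤n⊔m _ _)

module _ {p : ℕ} (G : Graph p) (π : Permutation′ p) where

  edgeWeight : Fin p → Fin p → ℕ
  edgeWeight u v = if adj G u v then label π u + label π v else 0

  strF-≤ : ∀ {b} → (∀ u v → adj G u v ≡ true → label π u + label π v ≤ b) → strF G π ≤ b
  strF-≤ {b} h =
    maxList-map-≤ _ (allFin p) λ u → maxList-map-≤ (edgeWeight u) (allFin p) (weight-≤ u)
    where
    weight-≤ : ∀ u v → edgeWeight u v ≤ b
    weight-≤ u v with adj G u v in e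
    ... | true  = h u v e
    ... | false = z≤n

  edge-≤-strF : ∀ u v → adj G u v ≡ true → label π u + label π v ≤ strF G π
  edge-≤-strF u v e =
    ≤-trans row-u (≤-maxList-map (λ u → maxList (map (edgeWeight u) (allFin p))) (∈-allFin u))
    where
    row-u : label π u + label π v ≤ maxList (map (edgeWeight u) (allFin p))
    row-u = subst (_≤ _) (cong (λ c → if c then label π u + label π v else 0) e)
                  (≤-maxList-map (edgeWeight u) (∈-allFin v))

-- The vertex numbered p has a neighbour, numbered at least 1.
suc-≤-strF : ∀ {p} (G : Graph p) → 1 ≤ p → (∀ v → Σ (Fin p) λ w → adj G v w ≡ true) →
             ∀ π → suc p ≤ strF G π
suc-≤-strF {suc q} G _ neighbour π with w , top~w ← neighbour (π ⟨$⟩ˡ fromℕ q) =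
  ≤-trans (p+1≤ w) (edge-≤-strF G π top w top~w)
  where
  top : Fin (suc q)
  top = π ⟨$⟩ˡ fromℕ q
  label-top : label π top ≡ suc q
  label-top = trans (cong (suc ∘ toℕ) (inverseʳ π)) (cong suc (toℕ-fromℕ q))
  p+1≤ : ∀ w → suc (suc q) ≤ label π top + label π w
  p+1≤ w = subst (λ l → suc (suc q) ≤ l + label π w) (sym label-top)
                 (s≤s (subst (suc q ≤_) (sym (+-suc q _)) (s≤s (m≤m+n q _))))

injective⇒surjective : ∀ {p} (f : Fin p → Fin p) → Injective _≡_ _≡_ f →
                       ∀ y → Σ (Fin p) λ x → f x ≡ y
injective⇒surjective {suc q} f inj y with any? (λ x → f x ≟ y)
... | yes hit  = hit
... | no  miss = contradiction (injective⇒≤ {f = squeeze} squeeze-injective) (<-irrefl refl)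
  where
  missed : ∀ x → y ≢ f x
  missed x e = miss (x , sym e)
  squeeze : Fin (suc q) → Fin q
  squeeze x = punchOut (missed x)
  squeeze-injective : Injective _≡_ _≡_ squeeze
  squeeze-injective {a} {b} e = inj (punchOut-injective (missed a) (missed b) e)

injective⇒permutation : ∀ {p} (f : Fin p → Fin p) → Injective _≡_ _≡_ f →
                        Σ (Permutation′ p) λ π → ∀ v → π ⟨$⟩ʳ v ≡ f v
injective⇒permutation f inj =
  permutation f (proj₁ ∘ onto) (proj₂ ∘ onto) (λ x → inj (proj₂ (onto (f x)))) , λ _ → refl
  where
  onto : ∀ y → Σ (Fin _) λ x → f x ≡ y
  onto = injective⇒surjective f inj

_[_↦_] : ∀ {A : Set} {p} → (Fin p → A) → Fin p → A → Fin p → A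
(f [ x ↦ c ]) w = if does (x ≟ w) then c else f w

-- U is the set of vertices still unlabelled; a low and b high labels are in use.
record PartialNumbering {p} (G : Graph p) (U : VertexSet p) (a b : ℕ) : Set where
  field
    ℓ           : Fin p → ℕ
    size        : card U + (a + b) ≡ p
    range       : ∀ v → U v ≡ false → (1 ≤ ℓ v × ℓ v ≤ a) ⊎ (p ∸ b < ℓ v × ℓ v ≤ p)
    injective   : ∀ u v → U u ≡ false → U v ≡ false → ℓ u ≡ ℓ v → u ≡ v
    high-closed : ∀ x y → U x ≡ false → a < ℓ x → adj G x y ≡ true →
                  U y ≡ false × ℓ x + ℓ y ≤ suc p
open PartialNumbering

module _ {p} (G : Graph p) where

  unlabelled : PartialNumbering G full 0 0
  unlabelled = record
    { ℓ           = λ _ → 0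
    ; size        = trans (+-identityʳ _) (card-full p)
    ; range       = λ _ ()
    ; injective   = λ _ _ ()
    ; high-closed = λ _ _ ()
    }

  reindex : ∀ {U U′ a b} → (∀ v → U v ≡ U′ v) → PartialNumbering G U a b → PartialNumbering G U′ a b
  reindex {U} {U′} {a} {b} e s = record
    { ℓ           = ℓ s
    ; size        = trans (cong (_+ (a + b)) (card-cong (sym ∘ e))) (size s)
    ; range       = λ v h → range s v (trans (e v) h)
    ; injective   = λ u v hu hv → injective s u v (trans (e u) hu) (trans (e v) hv)
    ; high-closed = λ x y hx lt x~y →
        let y-labelled , sum≤ = high-closed s x y (trans (e x) hx) lt x~y
        in trans (sym (e y)) y-labelled , sum≤
    }

  room : ∀ {U a b} → PartialNumbering G U a b → ∀ v → U v ≡ true → a + b < p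
  room {U} {a} {b} s v e = subst (a + b <_) (trans (+-comm (a + b) (card U)) (size s))
    (subst (_≤ a + b + card U) (+-comm (a + b) 1) (+-monoʳ-≤ (a + b) (card-positive U v e)))

  size-∖ : ∀ {U : VertexSet p} {m x} → U x ≡ true → card U + m ≡ p → card (U ∖ x) + suc m ≡ p
  size-∖ {U} {m} {x} Ux e =
    trans (+-suc (card (U ∖ x)) m) (trans (cong (_+ m) (sym (card-∖ U x Ux))) e)

  labelLow : ∀ {U a b} → PartialNumbering G U a b → ∀ v → U v ≡ true →
             PartialNumbering G (U ∖ v) (suc a) b
  labelLow {U} {a} {b} s v Uv = record
    { ℓ           = ℓ′
    ; size        = size-∖ Uv (size s)
    ; range       = range′
    ; injective   = injective′
    ; high-closed = high-closed′
    }
    where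
    ℓ′ : Fin p → ℕ
    ℓ′ = ℓ s [ v ↦ suc a ]
    high> : ∀ w → p ∸ b < ℓ s w → suc a < ℓ s w
    high> w lt = ≤-<-trans (m+n≤o⇒m≤o∸n (suc a) (room s v Uv)) lt
    fresh : ∀ w → U w ≡ false → ℓ s w ≢ suc a
    fresh w Uw e with range s w Uw
    ... | inj₁ (_ , ≤a)   = <-irrefl refl (subst (_≤ a) e ≤a)
    ... | inj₂ (high , _) = <-irrefl refl (subst (suc a <_) e (high> w high))
    range′ : ∀ w → (U ∖ v) w ≡ false → (1 ≤ ℓ′ w × ℓ′ w ≤ suc a) ⊎ (p ∸ b < ℓ′ w × ℓ′ w ≤ p)
    range′ w h with v ≟ w
    ... | yes refl = inj₁ (s≤s z≤n , ≤-refl)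
    ... | no v≢w with range s w (∧true-≡ h)
    ... | inj₁ (≥1 , ≤a) = inj₁ (≥1 , m≤n⇒m≤1+n ≤a)
    ... | inj₂ high      = inj₂ high
    injective′ : ∀ u w → (U ∖ v) u ≡ false → (U ∖ v) w ≡ false → ℓ′ u ≡ ℓ′ w → u ≡ w
    injective′ u w hu hw e with v ≟ u | v ≟ w
    ... | yes refl | yes refl = refl
    ... | yes refl | no v≢w   = contradiction (sym e) (fresh w (∧true-≡ hw))
    ... | no v≢u   | yes refl = contradiction e (fresh u (∧true-≡ hu))
    ... | no v≢u   | no v≢w   = injective s u w (∧true-≡ hu) (∧true-≡ hw) e
    high-closed′ : ∀ x y → (U ∖ v) x ≡ false → suc a < ℓ′ x → adj G x y ≡ true →
                   (U ∖ v) y ≡ false × ℓ′ x + ℓ′ y ≤ suc p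
    high-closed′ x y hx lt x~y with v ≟ x
    ... | yes refl = contradiction lt (<-irrefl refl)
    ... | no v≢x with high-closed s x y (∧true-≡ hx) (<-trans (n<1+n a) lt) x~y
    ... | Uy , sum≤ with v ≟ y
    ... | yes refl = true≢false (trans (sym Uv) Uy)
    ... | no _     = trans (∧-identityʳ (U y)) Uy , sum≤

  -- x receives the largest free label p - b; its neighbours are all low
  -- (a high neighbour would see x unlabelled), so the sums stay ≤ p + 1.
  labelHigh : ∀ {U a b} → PartialNumbering G U a b → ∀ x → U x ≡ true →
              (∀ y → adj G x y ≡ true → U y ≡ false) → a ≤ suc b →
              PartialNumbering G (U ∖ x) a (suc b)
  labelHigh {U} {a} {b} s x Ux nbrs a≤b+1 = record
    { ℓ           = ℓ′
    ; size        = trans (cong (_+_ (card (U ∖ x))) (+-suc a b)) (size-∖ Ux (size s))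
    ; range       = range′
    ; injective   = injective′
    ; high-closed = high-closed′
    }
    where
    ℓ′ : Fin p → ℕ
    ℓ′ = ℓ s [ x ↦ p ∸ b ]
    a+b<p : a + b < p
    a+b<p = room s x Ux
    b<p : b < p
    b<p = ≤-<-trans (m≤n+m b a) a+b<p
    a<p∸b : a < p ∸ b
    a<p∸b = m+n≤o⇒m≤o∸n (suc a) a+b<p
    p∸b-shifts : p ∸ suc b < p ∸ b
    p∸b-shifts = ∸-monoʳ-< (n<1+n b) b<p
    fresh : ∀ w → U w ≡ false → ℓ s w ≢ p ∸ b
    fresh w Uw e with range s w Uw
    ... | inj₁ (_ , ≤a)   = <-irrefl refl (≤-<-trans (subst (_≤ a) e ≤a) a<p∸b)
    ... | inj₂ (high , _) = <-irrefl refl (subst (p ∸ b <_) e high)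
    range′ : ∀ w → (U ∖ x) w ≡ false → (1 ≤ ℓ′ w × ℓ′ w ≤ a) ⊎ (p ∸ suc b < ℓ′ w × ℓ′ w ≤ p)
    range′ w h with x ≟ w
    ... | yes refl = inj₂ (p∸b-shifts , m∸n≤m p b)
    ... | no x≢w with range s w (∧true-≡ h)
    ... | inj₁ low           = inj₁ low
    ... | inj₂ (high , ≤p)   = inj₂ (<-trans p∸b-shifts high , ≤p)
    injective′ : ∀ u w → (U ∖ x) u ≡ false → (U ∖ x) w ≡ false → ℓ′ u ≡ ℓ′ w → u ≡ w
    injective′ u w hu hw e with x ≟ u | x ≟ w
    ... | yes refl | yes refl = refl
    ... | yes refl | no _     = contradiction (sym e) (fresh w (∧true-≡ hw))
    ... | no _     | yes refl = contradiction e (fresh u (∧true-≡ hu))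
    ... | no _     | no _     = injective s u w (∧true-≡ hu) (∧true-≡ hw) e
    low-neighbour : ∀ y → adj G x y ≡ true → ℓ s y ≤ a
    low-neighbour y x~y with range s y (nbrs y x~y)
    ... | inj₁ (_ , ≤a)   = ≤a
    ... | inj₂ (high , _) = true≢false (trans (sym Ux) (proj₁
            (high-closed s y x (nbrs y x~y) (<-trans a<p∸b high) (trans (Graph.sym G y x) x~y))))
    sum≤ : ∀ y → adj G x y ≡ true → p ∸ b + ℓ s y ≤ suc p
    sum≤ y x~y = begin
      p ∸ b + ℓ s y     ≤⟨ +-monoʳ-≤ (p ∸ b) (≤-trans (low-neighbour y x~y) a≤b+1) ⟩
      p ∸ b + suc b     ≡⟨ +-suc (p ∸ b) b ⟩
      suc (p ∸ b + b)   ≡⟨ cong suc (m∸n+n≡m (<⇒≤ b<p)) ⟩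
      suc p             ∎
      where open ≤-Reasoning
    high-closed′ : ∀ x′ y → (U ∖ x) x′ ≡ false → a < ℓ′ x′ → adj G x′ y ≡ true →
                   (U ∖ x) y ≡ false × ℓ′ x′ + ℓ′ y ≤ suc p
    high-closed′ x′ y hx lt x′~y with x ≟ x′
    ... | yes refl = cong (_∧ _) (nbrs y x′~y) ,
                     subst (λ l → p ∸ b + l ≤ suc p) (sym (if-not x≢y)) (sum≤ y x′~y)
      where
      x≢y : x ≢ y
      x≢y refl = true≢false (trans (sym Ux) (nbrs y x′~y))
      if-not : x ≢ y → ℓ′ y ≡ ℓ s y
      if-not x≢y rewrite dec-false (x ≟ y) x≢y = refl
    ... | no _ with high-closed s x′ y (∧true-≡ hx) lt x′~y
    ... | Uy , sum≤′ with x ≟ y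
    ... | yes refl = true≢false (trans (sym Ux) Uy)
    ... | no _     = trans (∧-identityʳ (U y)) Uy , sum≤′

  labelLowAll : ∀ {U a b} (S : VertexSet p) → (∀ v → S v ≡ true → U v ≡ true) →
                PartialNumbering G U a b → PartialNumbering G (U ─ S) (a + card S) b
  labelLowAll S S⊆U s = go (card S) S refl S⊆U s
    where
    go : ∀ {U a b} N (S : VertexSet p) → card S ≡ N → (∀ v → S v ≡ true → U v ≡ true) →
         PartialNumbering G U a b → PartialNumbering G (U ─ S) (a + N) b
    go {U} {a} {b} zero S e _ s = subst (λ c → PartialNumbering G (U ─ S) c b) (sym (+-identityʳ a))
                                    (reindex (sym ∘ ─-∅ U S e) s)
    go {U} {a} {b} (suc N) S e S⊆U s with v , Sv ← card-witness S (subst (1 ≤_) (sym e) (s≤s z≤n)) =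
      subst (λ c → PartialNumbering G (U ─ S) c b) (sym (+-suc a N))
        (reindex (∖-─-∖ U S Sv)
          (go N (S ∖ v) (suc-injective (trans (sym (card-∖ S v Sv)) e)) (∖-⊆ S⊆U v)
              (labelLow s v (S⊆U v Sv))))

  labelHighAll : ∀ {U a b} (S : VertexSet p) → (∀ v → S v ≡ true → U v ≡ true) →
                 (∀ x → S x ≡ true → ∀ y → adj G x y ≡ true → U y ≡ false) → a ≤ suc b →
                 PartialNumbering G U a b → PartialNumbering G (U ─ S) a (b + card S)
  labelHighAll S S⊆U nbrs a≤b+1 s = go (card S) S refl S⊆U nbrs a≤b+1 s
    where
    go : ∀ {U a b} N (S : VertexSet p) → card S ≡ N → (∀ v → S v ≡ true → U v ≡ true) →
         (∀ x → S x ≡ true → ∀ y → adj G x y ≡ true → U y ≡ false) → a ≤ suc b →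
         PartialNumbering G U a b → PartialNumbering G (U ─ S) a (b + N)
    go {U} {a} {b} zero S e _ _ _ s = subst (PartialNumbering G (U ─ S) a) (sym (+-identityʳ b))
                                            (reindex (sym ∘ ─-∅ U S e) s)
    go {U} {a} {b} (suc N) S e S⊆U nbrs a≤b+1 s
      with v , Sv ← card-witness S (subst (1 ≤_) (sym e) (s≤s z≤n)) =
      subst (PartialNumbering G (U ─ S) a) (sym (+-suc b N))
        (reindex (∖-─-∖ U S Sv)
          (go N (S ∖ v) (suc-injective (trans (sym (card-∖ S v Sv)) e)) (∖-⊆ S⊆U v) nbrs′
              (m≤n⇒m≤1+n a≤b+1) (labelHigh s v (S⊆U v Sv) (nbrs v Sv) a≤b+1)))
      where
      nbrs′ : ∀ x → (S ∖ v) x ≡ true → ∀ y → adj G x y ≡ true → (U ∖ v) y ≡ false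
      nbrs′ x h y x~y = cong (_∧ _) (nbrs x (∧-conicalˡ _ _ h) y x~y)

  toNumbering : ∀ {a b} → PartialNumbering G ∅ a b → a ≤ suc b →
                Σ (Permutation′ p) λ π → strF G π ≤ suc p
  toNumbering {a} {b} s a≤b+1 = π , strF-≤ G π edge
    where
    a+b≡p : a + b ≡ p
    a+b≡p = trans (cong (_+ (a + b)) (sym (card-∅ {p} (λ _ → refl)))) (size s)
    fromLabel : ∀ l → 1 ≤ l → l ≤ p → Σ (Fin p) λ i → suc (toℕ i) ≡ l
    fromLabel (suc l) _ l<p = fromℕ< l<p , cong suc (toℕ-fromℕ< l<p)
    in-range : ∀ v → Σ (Fin p) λ i → suc (toℕ i) ≡ ℓ s v
    in-range v with range s v refl
    ... | inj₁ (≥1 , ≤a) = fromLabel (ℓ s v) ≥1 (≤-trans ≤a (subst (a ≤_) a+b≡p (m≤m+n a b)))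
    ... | inj₂ (high , ≤p) = fromLabel (ℓ s v) (≤-trans (s≤s z≤n) high) ≤p
    numbering : Σ (Permutation′ p) λ π → ∀ v → π ⟨$⟩ʳ v ≡ proj₁ (in-range v)
    numbering = injective⇒permutation (proj₁ ∘ in-range) λ {u} {v} e →
      injective s u v refl refl (trans (sym (proj₂ (in-range u))) (trans (cong (suc ∘ toℕ) e) (proj₂ (in-range v))))
    π : Permutation′ p
    π = proj₁ numbering
    label≡ℓ : ∀ v → label π v ≡ ℓ s v
    label≡ℓ v = trans (cong (suc ∘ toℕ) (proj₂ numbering v)) (proj₂ (in-range v))
    edge′ : ∀ u v → adj G u v ≡ true → ℓ s u + ℓ s v ≤ suc p
    edge′ u v u~v with a <? ℓ s u | a <? ℓ s v
    ... | yes high | _        = proj₂ (high-closed s u v refl high u~v)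
    ... | no _     | yes high = subst (_≤ suc p) (+-comm (ℓ s v) (ℓ s u))
                                 (proj₂ (high-closed s v u refl high (trans (Graph.sym G v u) u~v)))
    ... | no low₁  | no low₂  = begin
      ℓ s u + ℓ s v   ≤⟨ +-mono-≤ (≮⇒≥ low₁) (≮⇒≥ low₂) ⟩
      a + a           ≤⟨ +-monoʳ-≤ a a≤b+1 ⟩
      a + suc b       ≡⟨ +-suc a b ⟩
      suc (a + b)     ≡⟨ cong suc a+b≡p ⟩
      suc p           ∎
      where open ≤-Reasoning
    edge : ∀ u v → adj G u v ≡ true → label π u + label π v ≤ suc p
    edge u v u~v = subst₂ (λ x y → x + y ≤ suc p) (sym (label≡ℓ u)) (sym (label≡ℓ v)) (edge′ u v u~v)

↑ˡ≢↑ʳ : ∀ {n k} (u : Fin n) (v : Fin k) → u ↑ˡ k ≢ n ↑ʳ v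
↑ˡ≢↑ʳ {n} {k} u v e with () ← trans (sym (splitAt-↑ˡ n u k)) (trans (cong (splitAt n) e) (splitAt-↑ʳ n k v))

module Union {n k} (H : Graph n) (T : Graph k) where

  G : Graph (n + k)
  G = H ⊕ T

  infixr 5 _⊎ᵛ_
  _⊎ᵛ_ : VertexSet n → VertexSet k → VertexSet (n + k)
  (A ⊎ᵛ C) w = [ A , C ]′ (splitAt n w)

  ⊎ᵛ-↑ˡ : ∀ A C v → (A ⊎ᵛ C) (v ↑ˡ k) ≡ A v
  ⊎ᵛ-↑ˡ A C v rewrite splitAt-↑ˡ n v k = refl

  ⊎ᵛ-↑ʳ : ∀ A C v → (A ⊎ᵛ C) (n ↑ʳ v) ≡ C v
  ⊎ᵛ-↑ʳ A C v rewrite splitAt-↑ʳ n k v = refl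

  ↑-elim : ∀ {ℓ} {P : Fin (n + k) → Set ℓ} → (∀ v → P (v ↑ˡ k)) → (∀ v → P (n ↑ʳ v)) → ∀ w → P w
  ↑-elim {P = P} left right w with splitAt n w | join-splitAt n k w
  ... | inj₁ v | e = subst P e (left v)
  ... | inj₂ v | e = subst P e (right v)

  ⊎ᵛ-cong : ∀ {A A′ C C′} → (∀ v → A v ≡ A′ v) → (∀ v → C v ≡ C′ v) →
            ∀ w → (A ⊎ᵛ C) w ≡ (A′ ⊎ᵛ C′) w
  ⊎ᵛ-cong eA eC w with splitAt n w
  ... | inj₁ v = eA v
  ... | inj₂ v = eC v

  card-⊎ᵛ : ∀ A C → card (A ⊎ᵛ C) ≡ card A + card C
  card-⊎ᵛ A C = trans (card-↑ n (A ⊎ᵛ C)) (cong₂ _+_ (card-cong (⊎ᵛ-↑ˡ A C)) (card-cong (⊎ᵛ-↑ʳ A C)))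
    where
    card-↑ : ∀ m (r : VertexSet (m + k)) → card r ≡ card (λ v → r (v ↑ˡ k)) + card (λ v → r (m ↑ʳ v))
    card-↑ zero    r = refl
    card-↑ (suc m) r = trans (cong (_+_ (bit (r zero))) (card-↑ m (r ∘ suc))) (sym (+-assoc (bit (r zero)) _ _))

  adj-↑ˡ : ∀ u v → adj G (u ↑ˡ k) (v ↑ˡ k) ≡ adj H u v
  adj-↑ˡ u v rewrite splitAt-↑ˡ n u k | splitAt-↑ˡ n v k = refl

  adj-↑ʳ : ∀ u v → adj G (n ↑ʳ u) (n ↑ʳ v) ≡ adj T u v
  adj-↑ʳ u v rewrite splitAt-↑ʳ n k u | splitAt-↑ʳ n k v = refl

  adj-↑ˡ↑ʳ : ∀ u v → adj G (u ↑ˡ k) (n ↑ʳ v) ≡ false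
  adj-↑ˡ↑ʳ u v rewrite splitAt-↑ˡ n u k | splitAt-↑ʳ n k v = refl

  adj-↑ʳ↑ˡ : ∀ u v → adj G (n ↑ʳ u) (v ↑ˡ k) ≡ false
  adj-↑ʳ↑ˡ u v rewrite splitAt-↑ʳ n k u | splitAt-↑ˡ n v k = refl

  ⊎ᵛ-∖ˡ : ∀ A C u w → ((A ⊎ᵛ C) ∖ (u ↑ˡ k)) w ≡ ((A ∖ u) ⊎ᵛ C) w
  ⊎ᵛ-∖ˡ A C u = ↑-elim left right
    where
    left : ∀ v → ((A ⊎ᵛ C) ∖ (u ↑ˡ k)) (v ↑ˡ k) ≡ ((A ∖ u) ⊎ᵛ C) (v ↑ˡ k)
    left v rewrite splitAt-↑ˡ n v k with u ≟ v
    ... | yes refl = cong (λ d → A u ∧ not d) (dec-true ((u ↑ˡ k) ≟ (u ↑ˡ k)) refl)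
    ... | no u≢v   = cong (λ d → A v ∧ not d) (dec-false ((u ↑ˡ k) ≟ (v ↑ˡ k)) (u≢v ∘ ↑ˡ-injective k u v))
    right : ∀ v → ((A ⊎ᵛ C) ∖ (u ↑ˡ k)) (n ↑ʳ v) ≡ ((A ∖ u) ⊎ᵛ C) (n ↑ʳ v)
    right v rewrite splitAt-↑ʳ n k v | dec-false ((u ↑ˡ k) ≟ (n ↑ʳ v)) (↑ˡ≢↑ʳ u v) = ∧-identityʳ (C v)

  ⊎ᵛ-∖ʳ : ∀ A C u w → ((A ⊎ᵛ C) ∖ (n ↑ʳ u)) w ≡ (A ⊎ᵛ (C ∖ u)) w
  ⊎ᵛ-∖ʳ A C u = ↑-elim left right
    where
    left : ∀ v → ((A ⊎ᵛ C) ∖ (n ↑ʳ u)) (v ↑ˡ k) ≡ (A ⊎ᵛ (C ∖ u)) (v ↑ˡ k)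
    left v rewrite splitAt-↑ˡ n v k | dec-false ((n ↑ʳ u) ≟ (v ↑ˡ k)) (↑ˡ≢↑ʳ v u ∘ sym) = ∧-identityʳ (A v)
    right : ∀ v → ((A ⊎ᵛ C) ∖ (n ↑ʳ u)) (n ↑ʳ v) ≡ (A ⊎ᵛ (C ∖ u)) (n ↑ʳ v)
    right v rewrite splitAt-↑ʳ n k v with u ≟ v
    ... | yes refl = cong (λ d → C u ∧ not d) (dec-true ((n ↑ʳ u) ≟ (n ↑ʳ u)) refl)
    ... | no u≢v   = cong (λ d → C v ∧ not d) (dec-false ((n ↑ʳ u) ≟ (n ↑ʳ v)) (u≢v ∘ ↑ʳ-injective n u v))

  ⊎ᵛ-─ : ∀ A C S S′ w → ((A ⊎ᵛ C) ─ (S ⊎ᵛ S′)) w ≡ ((A ─ S) ⊎ᵛ (C ─ S′)) w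
  ⊎ᵛ-─ A C S S′ w with splitAt n w
  ... | inj₁ v = refl
  ... | inj₂ v = refl

  ∅-⊎ᵛ : ∀ w → (∅ ⊎ᵛ ∅) w ≡ ∅ w
  ∅-⊎ᵛ w with splitAt n w
  ... | inj₁ _ = refl
  ... | inj₂ _ = refl

  neighbour-⊕ : MinDegPos H → MinDegPos T → ∀ w → Σ (Fin (n + k)) λ w′ → adj G w w′ ≡ true
  neighbour-⊕ δH δT = ↑-elim
    (λ v → let w , v~w = card-witness (adj H v) (subst (1 ≤_) (count≡card (adj H v)) (δH v))
           in w ↑ˡ k , trans (adj-↑ˡ v w) v~w)
    (λ v → let w , v~w = card-witness (adj T v) (subst (1 ≤_) (count≡card (adj T v)) (δT v))
           in n ↑ʳ w , trans (adj-↑ʳ v w) v~w)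

  full-⊎ᵛ : ∀ w → full w ≡ (full ⊎ᵛ full) w
  full-⊎ᵛ w with splitAt n w
  ... | inj₁ _ = refl
  ... | inj₂ _ = refl

  card-⊎ᵛ∅ : ∀ S → card (S ⊎ᵛ ∅) ≡ card S
  card-⊎ᵛ∅ S = trans (card-⊎ᵛ S ∅) (trans (cong (_+_ (card S)) (card-∅ {k} (λ _ → refl))) (+-identityʳ _))

  ⊆-⊎ᵛ : ∀ {S S′ A C} → (∀ v → S v ≡ true → A v ≡ true) → (∀ v → S′ v ≡ true → C v ≡ true) →
         ∀ w → (S ⊎ᵛ S′) w ≡ true → (A ⊎ᵛ C) w ≡ true
  ⊆-⊎ᵛ left right w with splitAt n w
  ... | inj₁ v = left v
  ... | inj₂ v = right v

  ∅-⊆ : ∀ {m} {A : VertexSet m} v → ∅ v ≡ true → A v ≡ true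
  ∅-⊆ v ()

  closed-⊎ᵛ∅ : ∀ {S A C} → (∀ x → S x ≡ true → ∀ y → adj H x y ≡ true → A y ≡ false) →
               ∀ x → (S ⊎ᵛ ∅) x ≡ true → ∀ y → adj G x y ≡ true → (A ⊎ᵛ C) y ≡ false
  closed-⊎ᵛ∅ closed x Sx y x~y with splitAt n x | splitAt n y
  ... | inj₁ u | inj₁ v = closed u Sx v x~y

  closed-↑ˡ : ∀ {A C} u → (∀ y → adj H u y ≡ true → A y ≡ false) →
              ∀ y → adj G (u ↑ˡ k) y ≡ true → (A ⊎ᵛ C) y ≡ false
  closed-↑ˡ {A} {C} u closed = ↑-elim
    (λ v u~v → trans (⊎ᵛ-↑ˡ A C v) (closed v (trans (sym (adj-↑ˡ u v)) u~v)))
    (λ v u~v → true≢false (trans (sym u~v) (adj-↑ˡ↑ʳ u v)))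

  closed-↑ʳ : ∀ {A C} u → (∀ y → adj T u y ≡ true → C y ≡ false) →
              ∀ y → adj G (n ↑ʳ u) y ≡ true → (A ⊎ᵛ C) y ≡ false
  closed-↑ʳ {A} {C} u closed = ↑-elim
    (λ v u~v → true≢false (trans (sym u~v) (adj-↑ʳ↑ˡ u v)))
    (λ v u~v → trans (⊎ᵛ-↑ʳ A C v) (closed v (trans (sym (adj-↑ʳ u v)) u~v)))

module _ {n} (H : Graph n) (A : Alive n) where

  isolated⇒alive : ∀ v → isolated H A v ≡ true → A v ≡ true
  isolated⇒alive v = ∧-conicalˡ (A v) _

  nonIso⇒alive : ∀ v → nonIso H A v ≡ true → A v ≡ true
  nonIso⇒alive v = ∧-conicalˡ (A v) _

  isolated-neighbour : ∀ v → isolated H A v ≡ true → ∀ w → adj H v w ≡ true → A w ≡ false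
  isolated-neighbour v iso w v~w with A w in Aw
  ... | false = refl
  ... | true  = true≢false (trans (sym (anyV-intro _ w (cong₂ _∧_ Aw v~w)))
                                 (trans (sym (not-involutive _)) (cong not (∧-conicalʳ (A v) _ iso))))

  nonIso-neighbour : ∀ u v → nonIso H A u ≡ true → adj H u v ≡ true → A v ≡ true → nonIso H A v ≡ true
  nonIso-neighbour u v nu u~v Av =
    cong₂ _∧_ Av (anyV-intro _ u (cong₂ _∧_ (nonIso⇒alive u nu) (trans (Graph.sym H v u) u~v)))

  ─-isolated : ∀ v → (A ─ isolated H A) v ≡ nonIso H A v
  ─-isolated v with A v | anyV (λ w → A w ∧ adj H v w)
  ... | true  | true  = refl
  ... | true  | false = refl
  ... | false | _     = refl

module _ {n} (H : Graph n) (A : Alive n) (c : Fin n) (nc : nonIso H A c ≡ true)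
         (clique : ∀ u v → nonIso H A u ≡ true → nonIso H A v ≡ true → u ≢ v → adj H u v ≡ true) where

  clique-degree : degA H A c ≡ count (nonIso H A) ∸ 1
  clique-degree = begin
    count (λ w → A w ∧ adj H c w)   ≡⟨ count≡card (λ w → A w ∧ adj H c w) ⟩
    card (λ w → A w ∧ adj H c w)    ≡⟨ card-cong neighbours≗ ⟩
    card (nonIso H A ∖ c)           ≡⟨ cong (_∸ 1) (card-∖ (nonIso H A) c nc) ⟨
    card (nonIso H A) ∸ 1           ≡⟨ cong (_∸ 1) (count≡card (nonIso H A)) ⟨
    count (nonIso H A) ∸ 1          ∎
    where
    open ≡-Reasoning
    neighbours≗ : ∀ w → (A w ∧ adj H c w) ≡ (nonIso H A ∖ c) w
    neighbours≗ w with c ≟ w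
    ... | yes refl = trans (cong (A c ∧_) (Graph.irrefl H c)) (trans (∧-zeroʳ (A c)) (sym (∧-zeroʳ _)))
    ... | no c≢w with nonIso H A w in nw
    ... | true  rewrite clique c w nc nw c≢w | nonIso⇒alive H A w nw = refl
    ... | false with A w ∧ adj H c w in e
    ... | false = refl
    ... | true  = true≢false (trans (sym (nonIso-neighbour H A c w nc (∧-conicalʳ _ _ e) (∧-conicalˡ _ _ e))) nw)

  clique-next : ∀ v → next H A c v ≡ false
  clique-next v with nonIso H A v in nv
  ... | false = refl
  ... | true with c ≟ v
  ... | yes _   = refl
  ... | no c≢v rewrite clique c v nc nv c≢v = refl

HighAhead : ∀ {p} → Graph p → VertexSet p → Set
HighAhead G U = Σ ℕ λ a → Σ ℕ λ b → PartialNumbering G U a b × a ≤ b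

HighAheadBy : ∀ {p} → Graph p → ℕ → VertexSet p → Set
HighAheadBy G b U = Σ ℕ λ a → PartialNumbering G U a b × a ≤ b

-- A step (m , d) labels m isolated vertices high, d neighbours low and the
-- chosen vertex high; the low labels must stay at most one ahead.
Schedulable : ℕ → ℕ → List (ℕ × ℕ) → Set
Schedulable a b []            = ⊤
Schedulable a b ((m , d) ∷ L) = a + d ≤ suc (b + m) × Schedulable (a + d) (suc (b + m)) L

NonnegPrefixSums : ℤ → List (ℕ × ℕ) → Set
NonnegPrefixSums E []      = ⊤
NonnegPrefixSums E (y ∷ L) = 0ℤ ℤ.≤ E ℤ.+ yval y × NonnegPrefixSums (E ℤ.+ yval y) L

nonneg⇒schedulable : ∀ a b L → NonnegPrefixSums (+ b ℤ.- + a) L → Schedulable a b L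
nonneg⇒schedulable a b []            _        = tt
nonneg⇒schedulable a b ((m , d) ∷ L) (0≤ , rest) =
  ℤ.drop‿+≤+ (ℤ.0≤i-j⇒j≤i (subst (0ℤ ℤ.≤_) shift 0≤)) ,
  nonneg⇒schedulable (a + d) (suc (b + m)) L (subst (λ E → NonnegPrefixSums E L) shift rest)
  where
  open +-*-Solver
  shift : (+ b ℤ.- + a) ℤ.+ yval (m , d) ≡ + suc (b + m) ℤ.- + (a + d)
  shift rewrite ℤ.pos-+ 1 (b + m) | ℤ.pos-+ b m | ℤ.pos-+ a d =
    solve 4 (λ a b m d → (b :- a) :+ ((m :+ con (+ 1)) :- d) := (con (+ 1) :+ (b :+ m)) :- (a :+ d))
          refl (+ a) (+ b) (+ m) (+ d)

nonneg-tail : ∀ K base acc xs → 0ℤ ℤ.≤ K ℤ.+ foldr _⊓_ base (zsFrom acc xs) → NonnegPrefixSums (K ℤ.+ acc) xs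
nonneg-tail K base acc []       _ = tt
nonneg-tail K base acc (x ∷ xs) h =
  subst (0ℤ ℤ.≤_) (sym (ℤ.+-assoc K acc (yval x))) (ℤ.≤-trans h (ℤ.+-monoʳ-≤ K (ℤ.i⊓j≤i _ _))) ,
  subst (λ E → NonnegPrefixSums E xs) (sym (ℤ.+-assoc K acc (yval x)))
    (nonneg-tail K base (acc ℤ.+ yval x) xs (ℤ.≤-trans h (ℤ.+-monoʳ-≤ K (ℤ.i⊓j≤j _ _))))

foldr-⊓-≤ : ∀ base l → foldr _⊓_ base l ℤ.≤ base
foldr-⊓-≤ base []      = ℤ.≤-refl
foldr-⊓-≤ base (x ∷ l) = ℤ.≤-trans (ℤ.i⊓j≤j x _) (foldr-⊓-≤ base l)

-- With K = E + y₁, every prefix sum E + y₁ + z_i is at least K + Z ≥ m₁ + 1.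
Zmin-bound⇒nonneg : ∀ E m₁ d₁ x xs → Zmin x xs ℤ.≤ + 0 → (+ d₁ ℤ.- Zmin x xs) ℤ.≤ E →
                    NonnegPrefixSums E ((m₁ , d₁) ∷ x ∷ xs)
Zmin-bound⇒nonneg E m₁ d₁ x xs Z≤0 d₁-Z≤E =
  0≤K , ℤ.≤-trans 0≤K+Z (ℤ.+-monoʳ-≤ K (foldr-⊓-≤ (yval x) (zsFrom (yval x) xs))) ,
  nonneg-tail K (yval x) (yval x) xs 0≤K+Z
  where
  open +-*-Solver
  Z y₁ K : ℤ
  Z = Zmin x xs
  y₁ = yval (m₁ , d₁)
  K = E ℤ.+ y₁
  identity : ((+ d₁ ℤ.- Z) ℤ.+ y₁) ℤ.+ Z ≡ + m₁ ℤ.+ + 1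
  identity = solve 3 (λ d Z m → ((d :- Z) :+ ((m :+ con (+ 1)) :- d)) :+ Z := m :+ con (+ 1)) refl (+ d₁) Z (+ m₁)
  0≤K+Z : 0ℤ ℤ.≤ K ℤ.+ Z
  0≤K+Z = ℤ.≤-trans (ℤ.+≤+ z≤n) (ℤ.≤-trans (ℤ.≤-reflexive (sym identity)) (ℤ.+-monoˡ-≤ Z (ℤ.+-monoˡ-≤ y₁ d₁-Z≤E)))
  0≤K : 0ℤ ℤ.≤ K
  0≤K = ℤ.≤-trans 0≤K+Z (ℤ.≤-trans (ℤ.+-monoʳ-≤ K Z≤0) (ℤ.≤-reflexive (ℤ.+-identityʳ K)))

module DSeqLabelling {n k} (H : Graph n) (T : Graph k) where
  open Union H T

  labelIsolated : ∀ {A C a b} → PartialNumbering G (A ⊎ᵛ C) a b → a ≤ suc b →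
                  PartialNumbering G (nonIso H A ⊎ᵛ C) a (b + count (isolated H A))
  labelIsolated {A} {C} {a} {b} s a≤b+1 =
    subst (PartialNumbering G (nonIso H A ⊎ᵛ C) a) (cong (_+_ b) (trans (card-⊎ᵛ∅ _) (sym (count≡card (isolated H A)))))
      (reindex G remaining
        (labelHighAll G (isolated H A ⊎ᵛ ∅) (⊆-⊎ᵛ (isolated⇒alive H A) ∅-⊆)
                      (closed-⊎ᵛ∅ (isolated-neighbour H A)) a≤b+1 s))
    where
    remaining : ∀ w → ((A ⊎ᵛ C) ─ (isolated H A ⊎ᵛ ∅)) w ≡ (nonIso H A ⊎ᵛ C) w
    remaining w = trans (⊎ᵛ-─ A C _ ∅ w) (⊎ᵛ-cong (─-isolated H A) (∧-identityʳ ∘ C) w)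

  labelNeighbourhood : ∀ {A C a b} u → nonIso H A u ≡ true →
                       PartialNumbering G (nonIso H A ⊎ᵛ C) a b → a + degA H A u ≤ suc b →
                       PartialNumbering G (next H A u ⊎ᵛ C) (a + degA H A u) (suc b)
  labelNeighbourhood {A} {C} {a} {b} u nu s fits =
    reindex G remaining
      (labelHigh G lowered (u ↑ˡ k) (trans (⊎ᵛ-↑ˡ _ C u) u-left) (closed-↑ˡ u neighbours-done) fits)
    where
    N : VertexSet n
    N v = A v ∧ adj H u v
    N⊆nonIso : ∀ v → N v ≡ true → nonIso H A v ≡ true
    N⊆nonIso v Nv = nonIso-neighbour H A u v nu (∧-conicalʳ (A v) _ Nv) (∧-conicalˡ (A v) _ Nv)
    lowered : PartialNumbering G ((nonIso H A ─ N) ⊎ᵛ C) (a + degA H A u) b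
    lowered = subst (λ c → PartialNumbering G ((nonIso H A ─ N) ⊎ᵛ C) c b) (cong (_+_ a) (trans (card-⊎ᵛ∅ N) (sym (count≡card N))))
      (reindex G (λ w → trans (⊎ᵛ-─ _ C N ∅ w) (⊎ᵛ-cong (λ _ → refl) (∧-identityʳ ∘ C) w))
        (labelLowAll G (N ⊎ᵛ ∅) (⊆-⊎ᵛ N⊆nonIso ∅-⊆) s))
    u-left : (nonIso H A ─ N) u ≡ true
    u-left rewrite nu | Graph.irrefl H u | ∧-zeroʳ (A u) = refl
    neighbours-done : ∀ y → adj H u y ≡ true → (nonIso H A ─ N) y ≡ false
    neighbours-done y u~y rewrite u~y with A y
    ... | false = refl
    ... | true  = ∧-zeroʳ _
    remaining : ∀ w → (((nonIso H A ─ N) ⊎ᵛ C) ∖ (u ↑ˡ k)) w ≡ (next H A u ⊎ᵛ C) w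
    remaining w = trans (⊎ᵛ-∖ˡ _ C u w) (⊎ᵛ-cong next≗ (λ _ → refl) w)
      where
      next≗ : ∀ v → ((nonIso H A ─ N) ∖ u) v ≡ next H A u v
      next≗ v with nonIso H A v in nv
      ... | false = refl
      ... | true rewrite nonIso⇒alive H A v nv with adj H u v | does (u ≟ v)
      ... | true  | true  = refl
      ... | true  | false = refl
      ... | false | true  = refl
      ... | false | false = refl

  labelDSeq : ∀ {A L} → DSeq H A L → ∀ {C a b} → PartialNumbering G (A ⊎ᵛ C) a b → a ≤ b →
              Schedulable a b L → HighAhead G (∅ ⊎ᵛ C)
  labelDSeq (stopK1 (none , _)) s a≤b _ =
    _ , _ , reindex G (⊎ᵛ-cong none (λ _ → refl)) (labelIsolated s (m≤n⇒m≤1+n a≤b)) ,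
    ≤-trans a≤b (m≤m+n _ _)
  -- The last graph m K₁ + K_r is one more step, at a vertex c of the clique.
  labelDSeq {A} (stopKr (clique , c , nc)) {a = a} {b} s a≤b (fits , _) =
    _ , _ , reindex G (⊎ᵛ-cong (clique-next H A c nc clique) (λ _ → refl))
                      (labelNeighbourhood c nc (labelIsolated s (m≤n⇒m≤1+n a≤b)) fits′) ,
    fits′
    where
    fits′ : a + degA H A c ≤ suc (b + count (isolated H A))
    fits′ = subst (λ d → a + d ≤ _) (sym (clique-degree H A c nc clique)) fits
  labelDSeq (step _ u nu ds) s a≤b (fits , rest) =
    labelDSeq ds (labelNeighbourhood u nu (labelIsolated s (m≤n⇒m≤1+n a≤b)) fits) fits rest

degree-one-neighbour : ∀ {k} (T : Graph k) u w y → deg T u ≡ 1 → adj T u w ≡ true → adj T u y ≡ true → y ≡ w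
degree-one-neighbour T u w y deg≡1 u~w u~y with w ≟ y
... | yes w≡y = sym w≡y
... | no  w≢y = true≢false (trans (sym (trans (∖-other (adj T u) w≢y) u~y)) (card≡0⇒∅ _ rest≡0 y))
  where
  rest≡0 : card (adj T u ∖ w) ≡ 0
  rest≡0 = suc-injective (trans (sym (card-∖ (adj T u) w u~w)) (trans (sym (count≡card (adj T u))) deg≡1))

module Pendants {k} (T : Graph k) where

  P : VertexSet k
  P = inP T

  pendant-degree : ∀ u → P u ≡ true → deg T u ≡ 1
  pendant-degree u Pu = ≡ᵇ⇒≡ (deg T u) 1 (Equivalence.from T-≡ (∧-conicalˡ _ _ Pu))

  anchor : ∀ u → P u ≡ true → Σ (Fin k) λ w → adj T u w ≡ true × P w ≡ false
  anchor u Pu with w , e ← anyV-witness _ (∧-conicalʳ (pendant T u) _ Pu) = w , ∧-conicalˡ _ _ e , not-pendant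
    where
    2≤deg : 2 ≤ deg T w
    2≤deg = ≤ᵇ⇒≤ 2 (deg T w) (Equivalence.from T-≡ (∧-conicalʳ _ _ e))
    not-pendant : P w ≡ false
    not-pendant with deg T w ≡ᵇ 1 in deg≡1
    ... | false = refl
    ... | true  = contradiction (subst (2 ≤_) (≡ᵇ⇒≡ (deg T w) 1 (Equivalence.from T-≡ deg≡1)) 2≤deg) λ { (s≤s ()) }

  -- pending Q: the vertices still unlabelled once the pendant vertices in
  -- P ─ Q have been labelled together with their neighbours.
  pending : VertexSet k → VertexSet k
  pending Q v = if P v then Q v else not (anyV (λ u → (P ─ Q) u ∧ adj T u v))

  pending-P-vertex : ∀ {Q u} → P u ≡ true → pending Q u ≡ Q u
  pending-P-vertex {Q} {u} Pu rewrite Pu = refl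

  pending-cong : ∀ {Q Q′} → (∀ v → Q v ≡ Q′ v) → ∀ v → pending Q v ≡ pending Q′ v
  pending-cong e v with P v
  ... | true  = e v
  ... | false = cong not (anyV-cong λ u → cong (λ c → (P u ∧ not c) ∧ adj T u v) (e u))

  pending-P : ∀ v → pending P v ≡ true
  pending-P v with P v
  ... | true  = refl
  ... | false = cong not (anyV-∅ _ λ u → cong (_∧ adj T u v) (∧-inverseʳ (P u)))

  pending-∅-covered : ∀ v → (pending ∅ v ∨ (P v ∨ inNP T v)) ≡ true
  pending-∅-covered v with P v
  ... | true  = refl
  ... | false rewrite anyV-cong {p = λ u → (P u ∧ true) ∧ adj T u v} (λ u → cong (_∧ adj T u v) (∧-identityʳ (P u)))
                with inNP T v
  ...   | true  = refl
  ...   | false = refl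

  module _ {Q : VertexSet k} {u w : Fin k} (Qu : Q u ≡ true) (Pu : P u ≡ true) (u~w : adj T u w ≡ true) (Pw : P w ≡ false) where

    pending-∖-self : pending (Q ∖ u) u ≡ false
    pending-∖-self rewrite Pu = ∖-self Q u

    pending-∖-anchor : pending (Q ∖ u) w ≡ false
    pending-∖-anchor rewrite Pw = cong not (anyV-intro _ u u-counts)
      where
      u-counts : ((P ─ (Q ∖ u)) u ∧ adj T u w) ≡ true
      u-counts rewrite Pu | ∖-self Q u | u~w = refl

    pending-∖-other : ∀ v → u ≢ v → w ≢ v → pending (Q ∖ u) v ≡ pending Q v
    pending-∖-other v u≢v w≢v with P v
    ... | true  = ∖-other Q u≢v
    ... | false = cong not (anyV-cong same)
      where
      same : ∀ u′ → ((P ─ (Q ∖ u)) u′ ∧ adj T u′ v) ≡ ((P ─ Q) u′ ∧ adj T u′ v)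
      same u′ with u ≟ u′
      ... | no _     = cong (λ c → (P u′ ∧ not c) ∧ adj T u′ v) (∧-identityʳ (Q u′))
      ... | yes refl rewrite Pu | Qu with adj T u v in u~v
      ...   | false = refl
      ...   | true  = contradiction (sym (degree-one-neighbour T u w v (pendant-degree u Pu) u~w u~v)) w≢v

    pending-step : ∀ v → ((pending Q ∖ w) ∖ u) v ≡ pending (Q ∖ u) v
    pending-step v = by-cases (w ≟ v) (u ≟ v)
      where
      by-cases : Dec (w ≡ v) → Dec (u ≡ v) → ((pending Q ∖ w) ∖ u) v ≡ pending (Q ∖ u) v
      by-cases (yes refl) _          = trans (cong (_∧ _) (∖-self (pending Q) w)) (sym pending-∖-anchor)
      by-cases (no _)     (yes refl) = trans (∖-self (pending Q ∖ w) u) (sym pending-∖-self)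
      by-cases (no w≢v)   (no u≢v)   = trans (∖-other (pending Q ∖ w) u≢v) (trans (∖-other (pending Q) w≢v) (sym (pending-∖-other v u≢v w≢v)))

module PendantLabelling {n k} (H : Graph n) (T : Graph k) where
  open Union H T
  open Pendants T

  labelPendant : ∀ {Q a b} u → Q u ≡ true → P u ≡ true →
                 PartialNumbering G (full ⊎ᵛ pending Q) a b → a ≤ b →
                 HighAheadBy G (suc b) (full ⊎ᵛ pending (Q ∖ u))
  labelPendant {Q} {a} {b} u Qu Pu s a≤b with w , u~w , Pw ← anchor u Pu | pending Q w in pw
  ... | true  = suc a , reindex G done (labelHigh G s₁ (n ↑ʳ u) u-free (closed-↑ʳ u anchor-done) (s≤s a≤b)) , s≤s a≤b
    where
    w≢u : w ≢ u
    w≢u refl = true≢false (trans (sym Pu) Pw)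
    s₁ : PartialNumbering G (full ⊎ᵛ (pending Q ∖ w)) (suc a) b
    s₁ = reindex G (⊎ᵛ-∖ʳ full (pending Q) w) (labelLow G s (n ↑ʳ w) (trans (⊎ᵛ-↑ʳ full _ w) pw))
    u-free : (full ⊎ᵛ (pending Q ∖ w)) (n ↑ʳ u) ≡ true
    u-free = trans (⊎ᵛ-↑ʳ full _ u) (trans (∖-other (pending Q) w≢u) (trans (pending-P-vertex Pu) Qu))
    anchor-done : ∀ y → adj T u y ≡ true → (pending Q ∖ w) y ≡ false
    anchor-done y u~y rewrite degree-one-neighbour T u w y (pendant-degree u Pu) u~w u~y = ∖-self (pending Q) w
    done : ∀ v → ((full ⊎ᵛ (pending Q ∖ w)) ∖ (n ↑ʳ u)) v ≡ (full ⊎ᵛ pending (Q ∖ u)) v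
    done v = trans (⊎ᵛ-∖ʳ full _ u v) (⊎ᵛ-cong (λ _ → refl) (pending-step Qu Pu u~w Pw) v)
  ... | false = a , reindex G done (labelHigh G s (n ↑ʳ u) u-free (closed-↑ʳ u anchor-done) (m≤n⇒m≤1+n a≤b)) , m≤n⇒m≤1+n a≤b
    where
    u-free : (full ⊎ᵛ pending Q) (n ↑ʳ u) ≡ true
    u-free = trans (⊎ᵛ-↑ʳ full _ u) (trans (pending-P-vertex Pu) Qu)
    anchor-done : ∀ y → adj T u y ≡ true → pending Q y ≡ false
    anchor-done y u~y rewrite degree-one-neighbour T u w y (pendant-degree u Pu) u~w u~y = pw
    done : ∀ v → ((full ⊎ᵛ pending Q) ∖ (n ↑ʳ u)) v ≡ (full ⊎ᵛ pending (Q ∖ u)) v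
    done v = trans (⊎ᵛ-∖ʳ full _ u v)
      (⊎ᵛ-cong (λ _ → refl) (λ v → trans (cong (_∧ _) (sym (∖-absent (pending Q) pw v))) (pending-step Qu Pu u~w Pw v)) v)

  labelPendants : ∀ N {Q a b} → card Q ≡ N → (∀ v → Q v ≡ true → P v ≡ true) →
                  PartialNumbering G (full ⊎ᵛ pending Q) a b → a ≤ b →
                  HighAheadBy G (b + N) (full ⊎ᵛ pending ∅)
  labelPendants zero {Q} {a} {b} e _ s a≤b =
    a , subst (λ c → PartialNumbering G _ a c) (sym (+-identityʳ b)) (reindex G nothing-left s) ,
    ≤-trans a≤b (m≤m+n b 0)
    where
    nothing-left : ∀ w → (full ⊎ᵛ pending Q) w ≡ (full ⊎ᵛ pending ∅) w
    nothing-left = ⊎ᵛ-cong (λ _ → refl) (pending-cong (card≡0⇒∅ Q e))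
  labelPendants (suc N) {Q} {a} {b} e Q⊆P s a≤b
    with u , Qu ← card-witness Q (subst (1 ≤_) (sym e) (s≤s z≤n))
    with a′ , s′ , a′≤b+1 ← labelPendant u Qu (Q⊆P u Qu) s a≤b
    with a″ , s″ , a″≤ ← labelPendants N (suc-injective (trans (sym (card-∖ Q u Qu)) e))
                                          (λ v h → Q⊆P v (∧-conicalˡ _ _ h)) s′ a′≤b+1
    rewrite +-suc b N = a″ , s″ , a″≤

  pendantPhase : HighAheadBy G (card P) (full ⊎ᵛ pending ∅)
  pendantPhase = labelPendants (card P) refl (λ _ h → h)
    (reindex G (λ w → trans (full-⊎ᵛ w) (⊎ᵛ-cong (λ _ → refl) (sym ∘ pending-P) w)) (unlabelled G)) z≤n

  -- Counting: the pending vertices, the pendant ones and their neighbours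
  -- together cover T, so the anchors used at most |N_T(P_T)| low labels.
  pendant-low-≤ : ∀ {a b} → PartialNumbering G (full ⊎ᵛ pending ∅) a b → b ≡ card P → a ≤ card (inNP T)
  pendant-low-≤ {a} {b} s refl =
    +-cancelˡ-≤ (card P) a _ (+-cancelˡ-≤ (card (pending ∅)) _ _ (begin
      card (pending ∅) + (card P + a)            ≡⟨ cong (_+_ (card (pending ∅))) (+-comm (card P) a) ⟩
      card (pending ∅) + (a + card P)            ≡⟨ size-T ⟩
      k                                          ≡⟨ card-full k ⟨
      card (full {k})                            ≤⟨ card-mono (λ v _ → pending-∅-covered v) ⟩
      card (λ v → pending ∅ v ∨ (P v ∨ inNP T v)) ≤⟨ card-∨ (pending ∅) _ ⟩
      card (pending ∅) + card (λ v → P v ∨ inNP T v) ≤⟨ +-monoʳ-≤ (card (pending ∅)) (card-∨ P (inNP T)) ⟩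
      card (pending ∅) + (card P + card (inNP T)) ∎))
    where
    open ≤-Reasoning
    size-T : card (pending ∅) + (a + card P) ≡ k
    size-T = +-cancelˡ-≡ n _ _ (begin-equality
      n + (card (pending ∅) + (a + card P))       ≡⟨ +-assoc n _ _ ⟨
      n + card (pending ∅) + (a + card P)         ≡⟨ cong (λ c → c + card (pending ∅) + (a + card P)) (card-full n) ⟨
      card (full {n}) + card (pending ∅) + (a + card P) ≡⟨ cong (_+ (a + card P)) (card-⊎ᵛ full (pending ∅)) ⟨
      card (full ⊎ᵛ pending ∅) + (a + card P)     ≡⟨ size s ⟩
      n + k                                       ∎)

module NonBacktrackingWalk {k} (T : Graph k) (s : ℕ → Fin k)
         (walk : ∀ i → adj T (s i) (s (suc i)) ≡ true)
         (no-backtrack : ∀ i → s (suc (suc i)) ≢ s i) where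

  InnerRepeat : ℕ → ℕ → Set
  InnerRepeat i g = Σ (Fin g) λ x → Σ (Fin g) λ y → toℕ x < toℕ y × s (i + toℕ x) ≡ s (i + toℕ y)

  -- Gap 1 is a loop and gap 2 a backtrack, so a simple return has length ≥ 3.
  simple-return⇒HasCycle : ∀ i g → s i ≡ s (i + g) → ¬ InnerRepeat i g → 1 ≤ g → HasCycle T
  simple-return⇒HasCycle i 1 e _ _ =
    true≢false (trans (sym (walk i)) (subst (λ z → adj T (s i) z ≡ false) (trans e (cong s (+-comm i 1))) (Graph.irrefl T (s i))))
  simple-return⇒HasCycle i 2 e _ _ = contradiction (trans (cong s (+-comm 2 i)) (sym e)) (no-backtrack i)
  simple-return⇒HasCycle i (suc (suc (suc j))) e simple _ = j , c , c-injective , edges , closing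
    where
    c : Fin (3 + j) → Fin k
    c t = s (i + toℕ t)
    c-injective : Injective _≡_ _≡_ c
    c-injective {x} {y} e′ with <-cmp (toℕ x) (toℕ y)
    ... | tri< x<y _ _ = contradiction (x , y , x<y , e′) simple
    ... | tri≈ _ x≡y _ = toℕ-injective x≡y
    ... | tri> _ _ y<x = contradiction (y , x , y<x , sym e′) simple
    edges : ∀ (t : Fin (2 + j)) → adj T (c (inject₁ t)) (c (suc t)) ≡ true
    edges t = subst₂ (λ a b → adj T (s a) (s b) ≡ true)
                (cong (_+_ i) (sym (toℕ-inject₁ t))) (sym (+-suc i (toℕ t))) (walk (i + toℕ t))
    closing : adj T (c (fromℕ (2 + j))) (c zero) ≡ true
    closing = subst₂ (λ a b → adj T (s a) b ≡ true)
                (cong (_+_ i) (sym (toℕ-fromℕ (2 + j))))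
                (trans (cong s (sym (+-suc i (2 + j)))) (trans (sym e) (cong s (sym (+-identityʳ i)))))
                (walk (i + (2 + j)))

  return⇒HasCycle : ∀ fuel i g → g ≤ fuel → 1 ≤ g → s i ≡ s (i + g) → HasCycle T
  return⇒HasCycle zero i g g≤0 1≤g _ = contradiction (≤-trans 1≤g g≤0) λ ()
  return⇒HasCycle (suc fuel) i g g≤fuel 1≤g e
    with any? {n = g} (λ x → any? {n = g} (λ y → (toℕ x <? toℕ y) ×-dec (s (i + toℕ x) ≟ s (i + toℕ y))))
  ... | no simple = simple-return⇒HasCycle i g e simple 1≤g
  ... | yes (x , y , x<y , e′) with o , x+o+1≡y ← m≤n⇒∃[o]m+o≡n x<y =
    return⇒HasCycle fuel (i + toℕ x) (suc o) shorter (s≤s z≤n)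
      (trans e′ (cong s (trans (cong (_+_ i) y≡x+o+1) (sym (+-assoc i (toℕ x) (suc o))))))
    where
    y≡x+o+1 : toℕ y ≡ toℕ x + suc o
    y≡x+o+1 = sym (trans (+-suc (toℕ x) o) x+o+1≡y)
    shorter : suc o ≤ fuel
    shorter = ≤-pred (≤-trans (s≤s (≤-trans (m≤n+m (suc o) (toℕ x)) (≤-reflexive (sym y≡x+o+1))))
                              (≤-trans (toℕ<n y) g≤fuel))

  walk⇒HasCycle : HasCycle T
  walk⇒HasCycle with i , j , i<j , e ← pigeonhole (n<1+n k) (λ (j : Fin (suc k)) → s (toℕ j))
                 with o , i+o≡j ← m≤n⇒∃[o]m+o≡n i<j
    = return⇒HasCycle (suc o) (toℕ i) (suc o) ≤-refl (s≤s z≤n) (trans e (cong s (sym (trans (+-suc (toℕ i) o) i+o≡j))))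

module Leaves {k} (T : Graph k) (C : VertexSet k) where

  C-neighbours : Fin k → VertexSet k
  C-neighbours v y = C y ∧ adj T v y

  module _ (branching : ∀ v → C v ≡ true → 2 ≤ card (C-neighbours v)) where

    onward : ∀ prev cur → C cur ≡ true → Σ (Fin k) λ y → C y ≡ true × adj T cur y ≡ true × y ≢ prev
    onward prev cur Ccur
      with y , h ← card-witness (C-neighbours cur ∖ prev) (≤-pred (≤-trans (branching cur Ccur) (card-∖-≤ _ prev)))
      = y , ∧-conicalˡ (C y) _ y-neighbour , ∧-conicalʳ (C y) _ y-neighbour , y≢prev
      where
      y-neighbour : C-neighbours cur y ≡ true
      y-neighbour = ∧-conicalˡ (C-neighbours cur y) _ h
      y≢prev : y ≢ prev
      y≢prev refl = true≢false (trans (sym h) (∖-self (C-neighbours cur) y))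

    record Edge : Set where
      constructor edge
      field
        from to : Fin k
        to∈C    : C to ≡ true
        from~to : adj T from to ≡ true

    advance : Edge → Edge
    advance (edge u v Cv _) with y , Cy , v~y , _ ← onward u v Cv = edge v y Cy v~y

    branching⇒HasCycle : ∀ v₀ → C v₀ ≡ true → HasCycle T
    branching⇒HasCycle v₀ Cv₀ = NonBacktrackingWalk.walk⇒HasCycle T (Edge.from ∘ walk) (Edge.from~to ∘ walk) no-backtrack
      where
      walk : ℕ → Edge
      walk zero with y , Cy , v₀~y , _ ← onward v₀ v₀ Cv₀ = edge v₀ y Cy v₀~y
      walk (suc i) = advance (walk i)
      no-backtrack : ∀ i → Edge.from (walk (suc (suc i))) ≢ Edge.from (walk i)
      no-backtrack i = proj₂ (proj₂ (proj₂ (onward (Edge.from (walk i)) (Edge.to (walk i)) (Edge.to∈C (walk i)))))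

  -- Otherwise every vertex of C has two C-neighbours, and a non-backtracking
  -- walk closes a cycle.
  leaf : IsForest T → (∀ v → C v ≡ true → anyV (C-neighbours v) ≡ true) → ∀ v₀ → C v₀ ≡ true →
         Σ (Fin k) λ u → Σ (Fin k) λ w → C u ≡ true × C w ≡ true × adj T u w ≡ true ×
           (∀ y → C y ≡ true → adj T u y ≡ true → y ≡ w)
  leaf forest has-neighbour v₀ Cv₀ with any? (λ u → (C u ≟ᵇ true) ×-dec (card (C-neighbours u) ≟ℕ 1))
  ... | no none = contradiction (branching⇒HasCycle branching v₀ Cv₀) forest
    where
    branching : ∀ v → C v ≡ true → 2 ≤ card (C-neighbours v)
    branching v Cv with y , vy ← anyV-witness (C-neighbours v) (has-neighbour v Cv)
                   with card (C-neighbours v) in e | card-positive (C-neighbours v) y vy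
    ... | suc (suc _) | _ = s≤s (s≤s z≤n)
    ... | suc zero    | _ = contradiction (v , Cv , e) none
  ... | yes (u , Cu , one) with w , uw ← card-witness (C-neighbours u) (≤-reflexive (sym one)) =
    u , w , Cu , ∧-conicalˡ (C w) _ uw , ∧-conicalʳ (C w) _ uw , unique
    where
    unique : ∀ y → C y ≡ true → adj T u y ≡ true → y ≡ w
    unique y Cy u~y with w ≟ y
    ... | yes w≡y = sym w≡y
    ... | no w≢y  = true≢false (trans (sym (trans (∖-other (C-neighbours u) w≢y) (cong₂ _∧_ Cy u~y)))
                                     (card≡0⇒∅ _ (suc-injective (trans (sym (card-∖ _ w uw)) one)) y))

module ForestLabelling {n k} (H : Graph n) (T : Graph k) (forest : IsForest T) where
  open Union H T
  open Leaves T

  nothing-pending : ∀ {C} → (∀ v → C v ≡ false) → ∀ {a b} →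
                    PartialNumbering G (∅ ⊎ᵛ C) a b → a ≤ b → HighAhead G (∅ ⊎ᵛ ∅)
  nothing-pending none s a≤b = _ , _ , reindex G (⊎ᵛ-cong (λ _ → refl) none) s , a≤b

  labelForest : ∀ fuel C → card C ≤ fuel → ∀ {a b} →
                PartialNumbering G (∅ ⊎ᵛ C) a b → a ≤ b → HighAhead G (∅ ⊎ᵛ ∅)
  labelForest zero C C≤0 s a≤b = nothing-pending (card≡0⇒∅ C (n≤0⇒n≡0 C≤0)) s a≤b
  labelForest (suc fuel) C C≤ {a} {b} s a≤b with any? (λ v → C v ≟ᵇ true)
  ... | no none = nothing-pending (λ v → ¬-not (λ Cv → none (v , Cv))) s a≤b
  ... | yes (v₀ , Cv₀) with any? (λ v → (C v ≟ᵇ true) ×-dec (anyV (C-neighbours C v) ≟ᵇ false))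
  ... | yes (v , Cv , lonely) =
    labelForest fuel (C ∖ v) (≤-pred (subst (_≤ suc fuel) (card-∖ C v Cv) C≤))
      (reindex G (⊎ᵛ-∖ʳ ∅ C v) (labelHigh G s (n ↑ʳ v) (trans (⊎ᵛ-↑ʳ ∅ C v) Cv) (closed-↑ʳ v no-pending) (m≤n⇒m≤1+n a≤b)))
      (m≤n⇒m≤1+n a≤b)
    where
    no-pending : ∀ y → adj T v y ≡ true → C y ≡ false
    no-pending y v~y with C y in Cy
    ... | false = refl
    ... | true  = true≢false (trans (sym (cong₂ _∧_ Cy v~y)) (anyV-none (C-neighbours C v) lonely y))
  ... | no none
    with u , w , Cu , Cw , u~w , unique ← leaf C forest (λ v Cv → ¬-not (λ e → none (v , Cv , e))) v₀ Cv₀ =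
    labelForest fuel ((C ∖ w) ∖ u) smaller
      (reindex G (⊎ᵛ-∖ʳ ∅ _ u) (labelHigh G s₁ (n ↑ʳ u) (trans (⊎ᵛ-↑ʳ ∅ _ u) Cwu) (closed-↑ʳ u anchor-done) (s≤s a≤b)))
      (s≤s a≤b)
    where
    w≢u : w ≢ u
    w≢u refl = true≢false (trans (sym u~w) (Graph.irrefl T u))
    Cwu : (C ∖ w) u ≡ true
    Cwu = trans (∖-other C w≢u) Cu
    smaller : card ((C ∖ w) ∖ u) ≤ fuel
    smaller = ≤-pred (≤-trans (n≤1+n _) (begin
      suc (suc (card ((C ∖ w) ∖ u))) ≡⟨ cong suc (card-∖ (C ∖ w) u Cwu) ⟨
      suc (card (C ∖ w))             ≡⟨ card-∖ C w Cw ⟨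
      card C                         ≤⟨ C≤ ⟩
      suc fuel                       ∎))
      where open ≤-Reasoning
    s₁ : PartialNumbering G (∅ ⊎ᵛ (C ∖ w)) (suc a) b
    s₁ = reindex G (⊎ᵛ-∖ʳ ∅ C w) (labelLow G s (n ↑ʳ w) (trans (⊎ᵛ-↑ʳ ∅ C w) Cw))
    anchor-done : ∀ y → adj T u y ≡ true → (C ∖ w) y ≡ false
    anchor-done y u~y with C y in Cy
    ... | false = refl
    ... | true rewrite unique y Cy u~y = cong not (dec-true (w ≟ w) refl)

gap⇒schedulable : ∀ {k} (T : Graph k) m₁ d₁ x xs → Zmin x xs ℤ.≤ + 0 →
  (+ count (inP T) ℤ.- + count (inNP T)) ℤ.≥ (+ d₁ ℤ.- Zmin x xs) →
  ∀ {a} → a ≤ card (inNP T) → Schedulable a (card (inP T)) ((m₁ , d₁) ∷ x ∷ xs)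
gap⇒schedulable T m₁ d₁ x xs Z≤0 gap {a} a≤ =
  nonneg⇒schedulable a _ _ (Zmin-bound⇒nonneg _ m₁ d₁ x xs Z≤0 (ℤ.≤-trans gap (begin
    + count (inP T) ℤ.- + count (inNP T)  ≡⟨ cong₂ (λ p q → + p ℤ.- + q) (count≡card (inP T)) (count≡card (inNP T)) ⟩
    + card (inP T) ℤ.- + card (inNP T)    ≤⟨ ℤ.+-monoʳ-≤ (+ card (inP T)) (ℤ.neg-mono-≤ (ℤ.+≤+ a≤)) ⟩
    + card (inP T) ℤ.- + a                ∎)))
  where open ℤ.≤-Reasoning

module _ {n k} (H : Graph n) (T : Graph k) where
  open Union H T
  open Pendants T
  open PendantLabelling H T
  open DSeqLabelling H T

  optimal-numbering : ∀ {L} → DSeq H allAlive L → IsForest T →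
    (∀ {a} → a ≤ card (inNP T) → Schedulable a (card P) L) →
    Σ (Permutation′ (n + k)) λ π → strF G π ≤ suc (n + k)
  optimal-numbering ds forest schedulable
    with a₁ , s₁ , a₁≤b₁ ← pendantPhase
    with a₂ , b₂ , s₂ , a₂≤b₂ ← labelDSeq ds s₁ a₁≤b₁ (schedulable (pendant-low-≤ s₁ refl))
    with a₃ , b₃ , s₃ , a₃≤b₃ ← ForestLabelling.labelForest H T forest _ (pending ∅) ≤-refl s₂ a₂≤b₂
    = toNumbering G (reindex G ∅-⊎ᵛ s₃) (m≤n⇒m≤1+n a₃≤b₃)

mainTheorem8 : ∀ {n k} (H : Graph n) (T : Graph k) →
    MinDegPos H →
    ∀ (m₁ d₁ : ℕ) (x : ℕ × ℕ) (xs : List (ℕ × ℕ)) →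
    DSeq H allAlive ((m₁ , d₁) ∷ x ∷ xs) →
    Zmin x xs ℤ.≤ + 0 →
    IsForest T → MinDegPos T → 3 ≤ k →
    (+ count (inP T) ℤ.- + count (inNP T)) ℤ.≥ (+ d₁ ℤ.- Zmin x xs) →
    StrEq (H ⊕ T) (n + k + 1)
mainTheorem8 {n} {k} H T δH m₁ d₁ x xs ds Z≤0 forest δT 3≤k gap =
  (π , ≤-antisym (subst (strF (H ⊕ T) π ≤_) p+1≡ strF≤) (lower π)) , lower
  where
  numbering : Σ (Permutation′ (n + k)) λ π → strF (H ⊕ T) π ≤ suc (n + k)
  numbering = optimal-numbering H T ds forest (gap⇒schedulable T m₁ d₁ x xs Z≤0 gap)
  π : Permutation′ (n + k)
  π = proj₁ numbering
  strF≤ : strF (H ⊕ T) π ≤ suc (n + k)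
  strF≤ = proj₂ numbering
  p+1≡ : suc (n + k) ≡ n + k + 1
  p+1≡ = +-comm 1 (n + k)
  lower : ∀ π → n + k + 1 ≤ strF (H ⊕ T) π
  lower π = subst (_≤ strF (H ⊕ T) π) p+1≡
    (suc-≤-strF (H ⊕ T) (≤-trans (s≤s z≤n) (≤-trans 3≤k (m≤n+m k n))) (Union.neighbour-⊕ H T δH δT) π)
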